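{- Let $D$ be a digraph and let $D_i$ be an irreducible component of $D$ (containing at least one arc) with period $p_i$ and periodic classes $P_{i,1},\ldots,P_{i,p_i}$. For $1\le j\le p_i$ let $V_{i,j}$ be the set of vertices $w$ such that in the power digraph $D^{p_i}$ there is a walk (possibly of length $0$) from $w$ to a vertex of $P_{i,j}$ or from a vertex of $P_{i,j}$ to $w$. If $j\neq j'$, then $P_{i,j}\cap V_{i,j'}=\emptyset$.
   Context: A digraph has vertex set $V$ and a multiset of arcs (ordered pairs). Irreducible components are maximal vertex sets (with induced subdigraphs) in which every vertex reaches every other by a walk. For an irreducible digraph, it is $p$-cyclic if its vertices can be partitioned into classes $P_1,\ldots,P_p$ with every arc going from $P_j$ to $P_{j+1}$ (indices mod $p$); the period is the largest such $p$ and the corresponding classes are the periodic classes. The power digraph $D^r$ has the same vertex set as $D$ and its arcs from $a$ to $b$ are in bijection with the walks of length $r$ from $a$ to $b$ in $D$. -}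

module Defs where

open import Data.Nat using (ℕ; zero; suc; _*_; _≤_)
open import Data.Fin using (Fin; toℕ; _≟_)
open import Data.Fin.Subset using (Subset; _∈_; _⊆_)
open import Data.List using (map; allFin)
open import Data.Nat.ListAction using (sum)
open import Data.Product using (Σ; ∃; _×_; _,_)
open import Data.Sum using (_⊎_)
open import Relation.Binary.PropositionalEquality using (_≡_)
open import Relation.Nullary using (yes; no)

-- A digraph on vertex set Fin n with a multiset of arcs:
-- A a b = number of arcs from a to b; the arcs from a to b are Fin (A a b).
Digraph : ℕ → Set
Digraph n = Fin n → Fin n → ℕ

Arc : ∀ {n} → Digraph n → Fin n → Fin n → Set
Arc D a b = Fin (D a b)

-- Power digraph: number of arcs a → b in D^r = number of walks of length r
-- from a to b in D (matrix power of the arc-count matrix).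
idDigraph : ∀ {n} → Digraph n
idDigraph a b with a ≟ b
... | yes _ = 1
... | no _  = 0

mulDigraph : ∀ {n} → Digraph n → Digraph n → Digraph n
mulDigraph {n} D E a c = sum (map (λ b → D a b * E b c) (allFin n))

pow : ∀ {n} → Digraph n → ℕ → Digraph n
pow D zero    = idDigraph
pow D (suc r) = mulDigraph D (pow D r)

data Walk {n} (D : Digraph n) : Fin n → Fin n → Set where
  nil  : ∀ {a} → Walk D a a
  cons : ∀ {a b c} → Arc D a b → Walk D b c → Walk D a c

data WalkIn {n} (D : Digraph n) (S : Subset n) : Fin n → Fin n → Set where
  nil  : ∀ {a} → a ∈ S → WalkIn D S a a
  cons : ∀ {a b c} → a ∈ S → Arc D a b → WalkIn D S b c → WalkIn D S a c

StronglyConnected : ∀ {n} → Digraph n → Subset n → Set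
StronglyConnected D S = ∀ a b → a ∈ S → b ∈ S → WalkIn D S a b

IsIrreducibleComponent : ∀ {n} → Digraph n → Subset n → Set
IsIrreducibleComponent D S =
  StronglyConnected D S ×
  (∀ T → S ⊆ T → StronglyConnected D T → T ⊆ S)

HasArc : ∀ {n} → Digraph n → Subset n → Set
HasArc D S = Σ _ λ a → Σ _ λ b → a ∈ S × b ∈ S × Arc D a b

NextMod : ∀ {p} → Fin p → Fin p → Set
NextMod {p} j j' = (suc (toℕ j) ≡ toℕ j') ⊎ (suc (toℕ j) ≡ p × toℕ j' ≡ 0)

-- cls restricted to S is a partition of S into p (nonempty) classes
-- P_0, ..., P_{p-1} (P_j = {v ∈ S | cls v ≡ j}) such that every arc of the
-- induced subdigraph goes from P_j to P_{j+1 mod p}.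
PeriodicPartition : ∀ {n} → Digraph n → Subset n → (p : ℕ) → (Fin n → Fin p) → Set
PeriodicPartition D S p cls =
  (∀ j → Σ _ λ v → v ∈ S × cls v ≡ j) ×
  (∀ a b → a ∈ S → b ∈ S → Arc D a b → NextMod (cls a) (cls b))

IsCyclic : ∀ {n} → Digraph n → Subset n → ℕ → Set
IsCyclic {n} D S p = Σ (Fin n → Fin p) λ cls → PeriodicPartition D S p cls

IsPeriod : ∀ {n} → Digraph n → Subset n → ℕ → Set
IsPeriod D S p = IsCyclic D S p × (∀ q → IsCyclic D S q → q ≤ p)

InV : ∀ {n} → Digraph n → Subset n → (p : ℕ) → (Fin n → Fin p) → Fin p → Fin n → Set
InV D S p cls j w =
  Σ _ λ u → u ∈ S × cls u ≡ j × (Walk (pow D p) w u ⊎ Walk (pow D p) u w)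

module Submission where

-- A walk of D^p is a walk of D whose length is a multiple of p.  If such a walk joins two
-- vertices of the component S, then S together with the vertices of the walk is strongly
-- connected, so by maximality the walk never leaves S.  Inside S every arc advances the
-- class index by one modulo p, so the walk returns to the class it started in.

open import Defs
open import Data.Nat using (ℕ; zero; suc; _+_; _*_; _%_; NonZero)
open import Data.Nat.Properties using (+-suc; +-identityʳ)
open import Data.Nat.DivMod using (%-distribˡ-+; m%n%n≡m%n; [m+kn]%n≡m%n; m<n⇒m%n≡m; n%n≡0)
open import Data.Nat.ListAction using (sum)
open import Data.Fin using (Fin; toℕ; splitAt; remQuot; _≟_)
open import Data.Fin.Properties using (toℕ<n; toℕ-injective)
open import Data.Fin.Subset using (Subset; _∈_; _⊆_; _∪_; ⁅_⁆)
open import Data.Fin.Subset.Properties using (p⊆p∪q; q⊆p∪q; x∈⁅x⁆; x∈⁅y⁆⇒x≡y; x∈p∪q⁻)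
open import Data.List using (List; []; _∷_; map; allFin)
open import Data.Product using (Σ; ∃; _,_)
open import Data.Sum using (_⊎_; inj₁; inj₂; [_,_])
open import Relation.Binary.PropositionalEquality using (_≡_; _≢_; refl; sym; trans; cong; module ≡-Reasoning)
open import Relation.Nullary using (¬_; yes; no)

data WalkOfLength {n} (D : Digraph n) : ℕ → Fin n → Fin n → Set where
  []  : ∀ {a} → WalkOfLength D 0 a a
  _∷_ : ∀ {L a b c} → Arc D a b → WalkOfLength D L b c → WalkOfLength D (suc L) a c

_++_ : ∀ {n} {D : Digraph n} {L M a b c} →
       WalkOfLength D L a b → WalkOfLength D M b c → WalkOfLength D (L + M) a c
[]      ++ v = v
(e ∷ w) ++ v = e ∷ (w ++ v)

index-sum : ∀ {A : Set} (f : A → ℕ) (xs : List A) → Fin (sum (map f xs)) → Σ A λ x → Fin (f x)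
index-sum f []       ()
index-sum f (x ∷ xs) i with splitAt (f x) i
... | inj₁ k = x , k
... | inj₂ k = index-sum f xs k

pow-arc⇒walkOfLength : ∀ {n} (D : Digraph n) r {a c} → Arc (pow D r) a c → WalkOfLength D r a c
pow-arc⇒walkOfLength D zero {a} {c} i with a ≟ c
... | yes refl = []
pow-arc⇒walkOfLength D zero () | no _
pow-arc⇒walkOfLength {n} D (suc r) {a} {c} i
  with index-sum (λ b → D a b * pow D r b c) (allFin n) i
... | b , k with remQuot (pow D r b c) k
...   | e , rest = e ∷ pow-arc⇒walkOfLength D r rest

pow-walk⇒walkOfLength : ∀ {n} (D : Digraph n) p {a c} →
                        Walk (pow D p) a c → ∃ λ k → WalkOfLength D (k * p) a c
pow-walk⇒walkOfLength D p nil = 0 , []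
pow-walk⇒walkOfLength D p (cons e w) with pow-walk⇒walkOfLength D p w
... | k , v = suc k , (pow-arc⇒walkOfLength D p e ++ v)

module _ {n} {D : Digraph n} where

  walkIn-mono : ∀ {A B a b} → A ⊆ B → WalkIn D A a b → WalkIn D B a b
  walkIn-mono A⊆B (nil a∈A)      = nil (A⊆B a∈A)
  walkIn-mono A⊆B (cons a∈A e w) = cons (A⊆B a∈A) e (walkIn-mono A⊆B w)

  _++ᵢ_ : ∀ {A a b c} → WalkIn D A a b → WalkIn D A b c → WalkIn D A a c
  nil _      ++ᵢ v = v
  cons a e w ++ᵢ v = cons a e (w ++ᵢ v)

-- The final vertex is not added: it will always lie in S already.
_∪vertices_ : ∀ {n} {D : Digraph n} {L a b} → Subset n → WalkOfLength D L a b → Subset n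
S ∪vertices []                = S
S ∪vertices (_∷_ {a = a} _ w) = ⁅ a ⁆ ∪ (S ∪vertices w)

module WalkThrough {n} {D : Digraph n} (S : Subset n) where

  ∪vertices-tail : ∀ {L a b c} (e : Arc D a b) (w : WalkOfLength D L b c) →
                   S ∪vertices w ⊆ S ∪vertices (e ∷ w)
  ∪vertices-tail {a = a} e w = q⊆p∪q ⁅ a ⁆ _

  ⊆-∪vertices : ∀ {L a b} (w : WalkOfLength D L a b) → S ⊆ S ∪vertices w
  ⊆-∪vertices []      x∈S = x∈S
  ⊆-∪vertices (e ∷ w) x∈S = ∪vertices-tail e w (⊆-∪vertices w x∈S)

  start∈∪vertices : ∀ {L a b} (w : WalkOfLength D L a b) → b ∈ S → a ∈ S ∪vertices w
  start∈∪vertices []                b∈S = b∈S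
  start∈∪vertices (_∷_ {a = a} _ w) _   = p⊆p∪q _ (x∈⁅x⁆ a)

  reachedFromStart : ∀ {L a b} (w : WalkOfLength D L a b) → b ∈ S →
                     ∀ {x} → x ∈ S ∪vertices w → x ∈ S ⊎ WalkIn D (S ∪vertices w) a x
  reachedFromStart [] _ x∈S = inj₁ x∈S
  reachedFromStart (_∷_ {a = a} e w) b∈S x∈ with x∈p∪q⁻ ⁅ a ⁆ _ x∈
  ... | inj₁ x∈⁅a⁆ with refl ← x∈⁅y⁆⇒x≡y a x∈⁅a⁆ = inj₂ (nil (start∈∪vertices (e ∷ w) b∈S))
  ... | inj₂ x∈w with reachedFromStart w b∈S x∈w
  ...   | inj₁ x∈S  = inj₁ x∈S
  ...   | inj₂ a'↝x = inj₂ (cons (start∈∪vertices (e ∷ w) b∈S) e (walkIn-mono (∪vertices-tail e w) a'↝x))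

  module _ (sc : StronglyConnected D S) where

    reachesEnd : ∀ {L a b} (w : WalkOfLength D L a b) → b ∈ S →
                 ∀ {x} → x ∈ S ∪vertices w → WalkIn D (S ∪vertices w) x b
    reachesEnd [] b∈S x∈S = sc _ _ x∈S b∈S
    reachesEnd (_∷_ {a = a} e w) b∈S x∈ with x∈p∪q⁻ ⁅ a ⁆ _ x∈
    ... | inj₁ x∈⁅a⁆ with refl ← x∈⁅y⁆⇒x≡y a x∈⁅a⁆ =
      cons (start∈∪vertices (e ∷ w) b∈S) e
           (walkIn-mono (∪vertices-tail e w) (reachesEnd w b∈S (start∈∪vertices w b∈S)))
    ... | inj₂ x∈w = walkIn-mono (∪vertices-tail e w) (reachesEnd w b∈S x∈w)

    ∪vertices-stronglyConnected : ∀ {L a b} (w : WalkOfLength D L a b) → a ∈ S → b ∈ S →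
                                  StronglyConnected D (S ∪vertices w)
    ∪vertices-stronglyConnected {a = a} {b} w a∈S b∈S x y x∈ y∈ =
      reachesEnd w b∈S x∈ ++ᵢ (inS (sc b a b∈S a∈S) ++ᵢ fromStart (reachedFromStart w b∈S y∈))
      where
      inS : ∀ {c d} → WalkIn D S c d → WalkIn D (S ∪vertices w) c d
      inS = walkIn-mono (⊆-∪vertices w)
      fromStart : y ∈ S ⊎ WalkIn D (S ∪vertices w) a y → WalkIn D (S ∪vertices w) a y
      fromStart = [ (λ y∈S → inS (sc a y a∈S y∈S)) , (λ a↝y → a↝y) ]

  component-walk-stays : IsIrreducibleComponent D S →
                         ∀ {L a b} (w : WalkOfLength D L a b) → a ∈ S → b ∈ S → S ∪vertices w ⊆ S
  component-walk-stays (sc , maximal) w a∈S b∈S =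
    maximal _ (⊆-∪vertices w) (∪vertices-stronglyConnected sc w a∈S b∈S)

open WalkThrough using (∪vertices-tail; start∈∪vertices; component-walk-stays)

[m%d+k]%d≡[m+k]%d : ∀ m k d .{{_ : NonZero d}} → (m % d + k) % d ≡ (m + k) % d
[m%d+k]%d≡[m+k]%d m k d = begin
  (m % d + k) % d             ≡⟨ %-distribˡ-+ (m % d) k d ⟩
  (m % d % d + k % d) % d     ≡⟨ cong (λ r → (r + k % d) % d) (m%n%n≡m%n m d) ⟩
  (m % d + k % d) % d         ≡⟨ %-distribˡ-+ m k d ⟨
  (m + k) % d                 ∎
  where open ≡-Reasoning

nextMod⇒suc-mod : ∀ {p} .{{_ : NonZero p}} {c c' : Fin p} → NextMod c c' → toℕ c' ≡ suc (toℕ c) % p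
nextMod⇒suc-mod {p} {c} {c'} (inj₁ c+1≡c')        = trans (sym (m<n⇒m%n≡m (toℕ<n c'))) (cong (_% p) (sym c+1≡c'))
nextMod⇒suc-mod {p}         (inj₂ (c+1≡p , c'≡0)) = trans c'≡0 (trans (sym (n%n≡0 p)) (cong (_% p) (sym c+1≡p)))

module _ {n} {D : Digraph n} {S : Subset n} {p} .{{_ : NonZero p}} {cls : Fin n → Fin p}
         (arcs : ∀ a b → a ∈ S → b ∈ S → Arc D a b → NextMod (cls a) (cls b)) where

  class-along-walk : ∀ {L a b} (w : WalkOfLength D L a b) → S ∪vertices w ⊆ S → b ∈ S →
                     toℕ (cls b) ≡ (toℕ (cls a) + L) % p
  class-along-walk {a = a} [] _ _ = begin
    toℕ (cls a)            ≡⟨ m<n⇒m%n≡m (toℕ<n (cls a)) ⟨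
    toℕ (cls a) % p        ≡⟨ cong (_% p) (+-identityʳ (toℕ (cls a))) ⟨
    (toℕ (cls a) + 0) % p  ∎
    where open ≡-Reasoning
  class-along-walk {suc L} {a} {c} (_∷_ {b = b} e w) stays c∈S = begin
    toℕ (cls c)                          ≡⟨ class-along-walk w (λ x∈ → stays (∪vertices-tail S e w x∈)) c∈S ⟩
    (toℕ (cls b) + L) % p                ≡⟨ cong (λ r → (r + L) % p) (nextMod⇒suc-mod (arcs a b a∈S b∈S e)) ⟩
    (suc (toℕ (cls a)) % p + L) % p      ≡⟨ [m%d+k]%d≡[m+k]%d (suc (toℕ (cls a))) L p ⟩
    (suc (toℕ (cls a)) + L) % p          ≡⟨ cong (_% p) (+-suc (toℕ (cls a)) L) ⟨
    (toℕ (cls a) + suc L) % p            ∎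
    where
    open ≡-Reasoning
    a∈S : a ∈ S
    a∈S = stays (start∈∪vertices S (e ∷ w) c∈S)
    b∈S : b ∈ S
    b∈S = stays (∪vertices-tail S e w (start∈∪vertices S w c∈S))

  class-preserved-by-pow-walk : IsIrreducibleComponent D S → ∀ {a b} → a ∈ S → b ∈ S →
                                Walk (pow D p) a b → cls a ≡ cls b
  class-preserved-by-pow-walk component {a} {b} a∈S b∈S a↝b with pow-walk⇒walkOfLength D p a↝b
  ... | k , w = toℕ-injective (begin
    toℕ (cls a)                ≡⟨ m<n⇒m%n≡m (toℕ<n (cls a)) ⟨
    toℕ (cls a) % p            ≡⟨ [m+kn]%n≡m%n (toℕ (cls a)) k p ⟨
    (toℕ (cls a) + k * p) % p  ≡⟨ class-along-walk w (component-walk-stays S component w a∈S b∈S) b∈S ⟨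
    toℕ (cls b)                ∎)
    where open ≡-Reasoning

mainTheorem13 : (n : ℕ) (D : Digraph n) (S : Subset n) →
    IsIrreducibleComponent D S → HasArc D S →
    (p : ℕ) → IsPeriod D S p →
    (cls : Fin n → Fin p) → PeriodicPartition D S p cls →
    (j j' : Fin p) → j ≢ j' →
    (v : Fin n) → v ∈ S → cls v ≡ j → ¬ InV D S p cls j' v
mainTheorem13 n D S _ _ zero _ _ _ () _ _ _ _ _ _
mainTheorem13 n D S component _ (suc q) _ cls (_ , arcs) j j' j≢j' v v∈S refl (u , u∈S , refl , v↝u⊎u↝v) =
  j≢j' ([ preserved v∈S u∈S , (λ u↝v → sym (preserved u∈S v∈S u↝v)) ] v↝u⊎u↝v)
  where
  preserved : ∀ {a b} → a ∈ S → b ∈ S → Walk (pow D (suc q)) a b → cls a ≡ cls b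
  preserved = class-preserved-by-pow-walk arcs component
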